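{- Let $k$ be an odd positive integer. For every integer $n>0$, let $b=\lfloor \log_2 n\rfloor$ and $c=n+1-2^{b}$. Then $$a_k(n)=\frac{(2^b+c)^k+(2^b-c)^k}{2^{b+1}}.$$
   Context: A P-position of the game of Nim with $k$ piles is a $k$-tuple $(p_1,\dots,p_k)$ of non-negative integers whose nim-sum $p_1\oplus\cdots\oplus p_k$ is $0$, where $\oplus$ denotes bitwise XOR. $a_k(n)$ denotes the number of P-positions with $k$ piles such that every pile has at most $n$ counters. -}

module Defs where

open import Data.Nat using (ℕ; zero; suc; _+_; _*_; _≟_)
open import Data.Nat.DivMod using (_/_; _%_)
open import Data.Bool using (Bool; true; false)
open import Data.List using (List; []; _∷_; concatMap; length; filter; upTo)
open import Data.Vec using (Vec; []; _∷_; foldr)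

-- Bitwise XOR on ℕ, by recursion on the binary expansion.
-- The fuel argument only serves termination; with fuel ≥ m + n it is exact.
xorF : ℕ → ℕ → ℕ → ℕ
xorF zero    m n = 0
xorF (suc f) m n =
  ((m % 2 + n % 2) % 2) + 2 * xorF f (m / 2) (n / 2)

infixl 6 _⊕_
_⊕_ : ℕ → ℕ → ℕ
m ⊕ n = xorF (m + n) m n

nimSum : ∀ {k} → Vec ℕ k → ℕ
nimSum = foldr _ _⊕_ 0

tuples : (k n : ℕ) → List (Vec ℕ k)
tuples zero    n = [] ∷ []
tuples (suc k) n = concatMap (λ x → Data.List.map (x ∷_) (tuples k n)) (upTo (suc n))

a : ℕ → ℕ → ℕ
a k n = length (filter (λ p → nimSum p ≟ 0) (tuples k n))

-- Let D_k(t) be the number of k-pile positions with piles ≤ n and nim-sum t, so that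
-- D_{k+1}(t) = Σ_{x ≤ n} D_k(x ⊕ t).  Write n + 1 = 2ᵇ + c with c ≤ 2ᵇ: the pile values form
-- the block [0, 2ᵇ) plus the first c values of [2ᵇ, 2ᵇ⁺¹), and ⊕ by a value below 2ᵇ permutes
-- each block, while ⊕ by 2ᵇ + r swaps them.  Hence the block totals L_k and U_k satisfy
-- L_{k+1} = 2ᵇ L_k + c U_k and U_{k+1} = 2ᵇ U_k + c L_k, giving L_k + U_k = (2ᵇ + c)ᵏ and
-- L_k − U_k = (2ᵇ − c)ᵏ.  The same recursion shows that D_k is constant on the lower block when
-- k is odd (and on the upper block when k is even), so a_k(n) = D_k(0) = L_k / 2ᵇ.

module Submission where

open import Defs
open import Data.Nat using (ℕ; zero; suc; _+_; _*_; _∸_; _^_; _≤_; _<_; z≤n; s≤s; NonZero; _≟_; _<?_; ⌊_/2⌋)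
open import Data.Nat.Properties
open import Data.Nat.DivMod
open import Data.Nat.Divisibility using (m∣m*n)
open import Data.Nat.Induction using (<-wellFounded)
open import Data.Nat.Logarithm using (⌊log₂_⌋)
open import Data.Nat.Logarithm.Core using (⌊log2⌋)
open import Data.Nat.Solver using (module +-*-Solver)
open import Data.List using (List; []; _∷_; _++_; map; filter; length; concatMap; applyUpTo)
open import Data.List.Properties using (filter-++; length-++; length-map; filter-≐)
open import Data.Vec using (Vec; _∷_)
open import Data.Product using (∃; _,_)
open import Induction.WellFounded using (Acc; acc)
open import Relation.Nullary using (yes; no)
open import Relation.Unary using (Pred; Decidable)
open import Relation.Binary.PropositionalEquality
open +-*-Solver using (solve; _:+_; _:*_; _:=_; con)

m≡m%2+2*[m/2] : ∀ m → m ≡ m % 2 + 2 * (m / 2)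
m≡m%2+2*[m/2] m = trans (m≡m%n+[m/n]*n m 2) (cong (m % 2 +_) (*-comm (m / 2) 2))

[i+2*q]%2≡i : ∀ {i} q → i < 2 → (i + 2 * q) % 2 ≡ i
[i+2*q]%2≡i {i} q i<2 = trans (%-remove-+ʳ i (m∣m*n q)) (m<n⇒m%n≡m i<2)

[i+2*q]/2≡q : ∀ {i} q → i < 2 → (i + 2 * q) / 2 ≡ q
[i+2*q]/2≡q {i} q i<2 = begin
  (i + 2 * q) / 2     ≡⟨ +-distrib-/-∣ʳ i (m∣m*n q) ⟩
  i / 2 + 2 * q / 2   ≡⟨ cong₂ _+_ (m<n⇒m/n≡0 i<2) (trans (cong (_/ 2) (*-comm 2 q)) (m*n/n≡m q 2)) ⟩
  q                   ∎
  where open ≡-Reasoning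

m≤1+n⇒m/2≤n : ∀ {m n} → m ≤ suc n → m / 2 ≤ n
m≤1+n⇒m/2≤n {m} {n} m≤1+n = ≤-trans (/-monoˡ-≤ 2 m≤1+n) (≤-pred (m/n<m (suc n) 2 (s≤s (s≤s z≤n))))

m<2*n⇒m/2<n : ∀ {m} n → m < 2 * n → m / 2 < n
m<2*n⇒m/2<n {m} n m<2n = m<n*o⇒m/o<n (subst (m <_) (*-comm 2 n) m<2n)

xorF-fuel-irrelevant : ∀ f g {m n} → m ≤ f → n ≤ f → m ≤ g → n ≤ g → xorF f m n ≡ xorF g m n
xorF-fuel-irrelevant zero    g       z≤n z≤n _   _   = sym (xorF-0-0 g)
  where
  xorF-0-0 : ∀ g → xorF g 0 0 ≡ 0
  xorF-0-0 zero    = refl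
  xorF-0-0 (suc g) = cong (2 *_) (xorF-0-0 g)
xorF-fuel-irrelevant (suc f) zero    z≤n z≤n z≤n z≤n =
  cong (2 *_) (xorF-fuel-irrelevant f zero z≤n z≤n z≤n z≤n)
xorF-fuel-irrelevant (suc f) (suc g) {m} {n} m≤f n≤f m≤g n≤g =
  cong (λ q → (m % 2 + n % 2) % 2 + 2 * q)
    (xorF-fuel-irrelevant f g (m≤1+n⇒m/2≤n m≤f) (m≤1+n⇒m/2≤n n≤f) (m≤1+n⇒m/2≤n m≤g) (m≤1+n⇒m/2≤n n≤g))

⊕-unfold : ∀ m n → m ⊕ n ≡ (m % 2 + n % 2) % 2 + 2 * (m / 2 ⊕ n / 2)
⊕-unfold m n = go (m + n) refl
  where
  go : ∀ f → f ≡ m + n → xorF f m n ≡ (m % 2 + n % 2) % 2 + 2 * (m / 2 ⊕ n / 2)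
  go zero    0≡m+n with m+n≡0⇒m≡0 m (sym 0≡m+n) | m+n≡0⇒n≡0 m (sym 0≡m+n)
  ... | refl | refl = refl
  go (suc f) f≡m+n = cong (λ q → (m % 2 + n % 2) % 2 + 2 * q)
    (xorF-fuel-irrelevant f (m / 2 + n / 2)
      (m≤1+n⇒m/2≤n (subst (m ≤_) (sym f≡m+n) (m≤m+n m n)))
      (m≤1+n⇒m/2≤n (subst (n ≤_) (sym f≡m+n) (m≤n+m n m)))
      (m≤m+n _ _) (m≤n+m _ _))

[m%2+n%2]%2<2 : ∀ m n → (m % 2 + n % 2) % 2 < 2
[m%2+n%2]%2<2 m n = m%n<n (m % 2 + n % 2) 2

[m⊕n]%2≡[m%2+n%2]%2 : ∀ m n → (m ⊕ n) % 2 ≡ (m % 2 + n % 2) % 2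
[m⊕n]%2≡[m%2+n%2]%2 m n =
  trans (cong (_% 2) (⊕-unfold m n)) ([i+2*q]%2≡i (m / 2 ⊕ n / 2) ([m%2+n%2]%2<2 m n))

[m⊕n]/2≡m/2⊕n/2 : ∀ m n → (m ⊕ n) / 2 ≡ m / 2 ⊕ n / 2
[m⊕n]/2≡m/2⊕n/2 m n =
  trans (cong (_/ 2) (⊕-unfold m n)) ([i+2*q]/2≡q (m / 2 ⊕ n / 2) ([m%2+n%2]%2<2 m n))

⊕-comm : ∀ m n → m ⊕ n ≡ n ⊕ m
⊕-comm m n = go (m + n) (m≤m+n m n) (m≤n+m n m)
  where
  go : ∀ f {m n} → m ≤ f → n ≤ f → m ⊕ n ≡ n ⊕ m
  go zero    z≤n z≤n = refl
  go (suc f) {m} {n} m≤f n≤f = begin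
    m ⊕ n                                          ≡⟨ ⊕-unfold m n ⟩
    (m % 2 + n % 2) % 2 + 2 * (m / 2 ⊕ n / 2)      ≡⟨ cong₂ (λ i q → i % 2 + 2 * q) (+-comm (m % 2) (n % 2))
                                                       (go f (m≤1+n⇒m/2≤n m≤f) (m≤1+n⇒m/2≤n n≤f)) ⟩
    (n % 2 + m % 2) % 2 + 2 * (n / 2 ⊕ m / 2)      ≡⟨ ⊕-unfold n m ⟨
    n ⊕ m                                          ∎
    where open ≡-Reasoning

⊕-identityʳ : ∀ m → m ⊕ 0 ≡ m
⊕-identityʳ m = go m ≤-refl
  where
  go : ∀ f {m} → m ≤ f → m ⊕ 0 ≡ m
  go zero    z≤n = refl
  go (suc f) {m} m≤f = begin
    m ⊕ 0                                  ≡⟨ ⊕-unfold m 0 ⟩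
    (m % 2 + 0) % 2 + 2 * (m / 2 ⊕ 0)
      ≡⟨ cong₂ (λ i q → i % 2 + 2 * q) (+-identityʳ (m % 2)) (go f (m≤1+n⇒m/2≤n m≤f)) ⟩
    m % 2 % 2 + 2 * (m / 2)                ≡⟨ cong (_+ 2 * (m / 2)) (m%n%n≡m%n m 2) ⟩
    m % 2 + 2 * (m / 2)                    ≡⟨ m≡m%2+2*[m/2] m ⟨
    m                                      ∎
    where open ≡-Reasoning

⊕-identityˡ : ∀ m → 0 ⊕ m ≡ m
⊕-identityˡ m = trans (⊕-comm 0 m) (⊕-identityʳ m)

⊕-same : ∀ m → m ⊕ m ≡ 0
⊕-same m = go m ≤-refl
  where
  [m+m]%2≡0 : ∀ m → (m + m) % 2 ≡ 0
  [m+m]%2≡0 m = trans (cong (_% 2) (trans (cong (m +_) (sym (+-identityʳ m))) (*-comm 2 m))) (m*n%n≡0 m 2)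
  go : ∀ f {m} → m ≤ f → m ⊕ m ≡ 0
  go zero    z≤n = refl
  go (suc f) {m} m≤f = begin
    m ⊕ m                                    ≡⟨ ⊕-unfold m m ⟩
    (m % 2 + m % 2) % 2 + 2 * (m / 2 ⊕ m / 2)
      ≡⟨ cong₂ (λ i q → i + 2 * q) ([m+m]%2≡0 (m % 2)) (go f (m≤1+n⇒m/2≤n m≤f)) ⟩
    0                                         ∎
    where open ≡-Reasoning

⊕-assoc : ∀ x y z → (x ⊕ y) ⊕ z ≡ x ⊕ (y ⊕ z)
⊕-assoc x y z = go (x + y + z) (≤-trans (m≤m+n x y) (m≤m+n _ z)) (≤-trans (m≤n+m y x) (m≤m+n _ z)) (m≤n+m z _)
  where
  [[a+b]%2+c]%2≡[a+[b+c]%2]%2 : ∀ a b c → ((a + b) % 2 + c) % 2 ≡ (a + (b + c) % 2) % 2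
  [[a+b]%2+c]%2≡[a+[b+c]%2]%2 a b c = begin
    ((a + b) % 2 + c) % 2  ≡⟨ %-distribˡ-+ ((a + b) % 2) c 2 ⟩
    ((a + b) % 2 % 2 + c % 2) % 2 ≡⟨ cong (λ u → (u + c % 2) % 2) (m%n%n≡m%n (a + b) 2) ⟩
    ((a + b) % 2 + c % 2) % 2 ≡⟨ %-distribˡ-+ (a + b) c 2 ⟨
    (a + b + c) % 2        ≡⟨ cong (_% 2) (+-assoc a b c) ⟩
    (a + (b + c)) % 2      ≡⟨ %-distribˡ-+ a (b + c) 2 ⟩
    (a % 2 + (b + c) % 2) % 2 ≡⟨ cong (λ u → (a % 2 + u) % 2) (m%n%n≡m%n (b + c) 2) ⟨
    (a % 2 + (b + c) % 2 % 2) % 2 ≡⟨ %-distribˡ-+ a ((b + c) % 2) 2 ⟨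
    (a + (b + c) % 2) % 2  ∎
    where open ≡-Reasoning
  go : ∀ f {x y z} → x ≤ f → y ≤ f → z ≤ f → (x ⊕ y) ⊕ z ≡ x ⊕ (y ⊕ z)
  go zero    z≤n z≤n z≤n = refl
  go (suc f) {x} {y} {z} x≤f y≤f z≤f = begin
    (x ⊕ y) ⊕ z
      ≡⟨ ⊕-unfold (x ⊕ y) z ⟩
    ((x ⊕ y) % 2 + z % 2) % 2 + 2 * ((x ⊕ y) / 2 ⊕ z / 2)
      ≡⟨ cong₂ (λ i q → (i + z % 2) % 2 + 2 * (q ⊕ z / 2)) ([m⊕n]%2≡[m%2+n%2]%2 x y) ([m⊕n]/2≡m/2⊕n/2 x y) ⟩
    ((x % 2 + y % 2) % 2 + z % 2) % 2 + 2 * ((x / 2 ⊕ y / 2) ⊕ z / 2)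
      ≡⟨ cong₂ (λ i q → i + 2 * q) ([[a+b]%2+c]%2≡[a+[b+c]%2]%2 (x % 2) (y % 2) (z % 2))
           (go f (m≤1+n⇒m/2≤n x≤f) (m≤1+n⇒m/2≤n y≤f) (m≤1+n⇒m/2≤n z≤f)) ⟩
    (x % 2 + (y % 2 + z % 2) % 2) % 2 + 2 * (x / 2 ⊕ (y / 2 ⊕ z / 2))
      ≡⟨ cong₂ (λ i q → (x % 2 + i) % 2 + 2 * (x / 2 ⊕ q)) ([m⊕n]%2≡[m%2+n%2]%2 y z) ([m⊕n]/2≡m/2⊕n/2 y z) ⟨
    (x % 2 + (y ⊕ z) % 2) % 2 + 2 * (x / 2 ⊕ (y ⊕ z) / 2)
      ≡⟨ ⊕-unfold x (y ⊕ z) ⟨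
    x ⊕ (y ⊕ z) ∎
    where open ≡-Reasoning

x⊕[x⊕y]≡y : ∀ x y → x ⊕ (x ⊕ y) ≡ y
x⊕[x⊕y]≡y x y = begin
  x ⊕ (x ⊕ y) ≡⟨ ⊕-assoc x x y ⟨
  (x ⊕ x) ⊕ y ≡⟨ cong (_⊕ y) (⊕-same x) ⟩
  0 ⊕ y       ≡⟨ ⊕-identityˡ y ⟩
  y           ∎
  where open ≡-Reasoning

2^b⊕l≡2^b+l : ∀ b {l} → l < 2 ^ b → 2 ^ b ⊕ l ≡ 2 ^ b + l
2^b⊕l≡2^b+l zero    (s≤s z≤n) = refl
2^b⊕l≡2^b+l (suc b) {l} l<2P = begin
  2 * P ⊕ l                                               ≡⟨ ⊕-unfold (2 * P) l ⟩
  ((2 * P) % 2 + l % 2) % 2 + 2 * ((2 * P) / 2 ⊕ l / 2)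
    ≡⟨ cong₂ (λ i q → (i + l % 2) % 2 + 2 * (q ⊕ l / 2)) ([i+2*q]%2≡i P (s≤s z≤n)) ([i+2*q]/2≡q P (s≤s z≤n)) ⟩
  l % 2 % 2 + 2 * (P ⊕ l / 2)
    ≡⟨ cong₂ (λ i q → i + 2 * q) (m%n%n≡m%n l 2) (2^b⊕l≡2^b+l b (m<2*n⇒m/2<n P l<2P)) ⟩
  l % 2 + 2 * (P + l / 2)
    ≡⟨ solve 3 (λ i p q → i :+ con 2 :* (p :+ q) := con 2 :* p :+ (i :+ con 2 :* q)) refl (l % 2) P (l / 2) ⟩
  2 * P + (l % 2 + 2 * (l / 2))                           ≡⟨ cong (2 * P +_) (m≡m%2+2*[m/2] l) ⟨
  2 * P + l                                               ∎
  where
  open ≡-Reasoning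
  P = 2 ^ b

⊕-<-2^ : ∀ b {x y} → x < 2 ^ b → y < 2 ^ b → x ⊕ y < 2 ^ b
⊕-<-2^ zero    (s≤s z≤n) (s≤s z≤n) = s≤s z≤n
⊕-<-2^ (suc b) {x} {y} x<2P y<2P = subst (_< 2 * P) (sym (⊕-unfold x y)) (begin-strict
  i + 2 * q       <⟨ +-monoˡ-< (2 * q) ([m%2+n%2]%2<2 x y) ⟩
  2 + 2 * q       ≡⟨ *-suc 2 q ⟨
  2 * suc q       ≤⟨ *-monoʳ-≤ 2 (⊕-<-2^ b (m<2*n⇒m/2<n P x<2P) (m<2*n⇒m/2<n P y<2P)) ⟩
  2 * P           ∎)
  where
  open ≤-Reasoning
  P = 2 ^ b
  i = (x % 2 + y % 2) % 2
  q = x / 2 ⊕ y / 2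

module _ (b : ℕ) {x y : ℕ} (x<2^b : x < 2 ^ b) (y<2^b : y < 2 ^ b) where

  [2^b+x]⊕y≡2^b+[x⊕y] : (2 ^ b + x) ⊕ y ≡ 2 ^ b + (x ⊕ y)
  [2^b+x]⊕y≡2^b+[x⊕y] = begin
    (2 ^ b + x) ⊕ y   ≡⟨ cong (_⊕ y) (2^b⊕l≡2^b+l b x<2^b) ⟨
    (2 ^ b ⊕ x) ⊕ y   ≡⟨ ⊕-assoc (2 ^ b) x y ⟩
    2 ^ b ⊕ (x ⊕ y)   ≡⟨ 2^b⊕l≡2^b+l b (⊕-<-2^ b x<2^b y<2^b) ⟩
    2 ^ b + (x ⊕ y)   ∎
    where open ≡-Reasoning

  x⊕[2^b+y]≡2^b+[x⊕y] : x ⊕ (2 ^ b + y) ≡ 2 ^ b + (x ⊕ y)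
  x⊕[2^b+y]≡2^b+[x⊕y] = begin
    x ⊕ (2 ^ b + y)   ≡⟨ cong (x ⊕_) (2^b⊕l≡2^b+l b y<2^b) ⟨
    x ⊕ (2 ^ b ⊕ y)   ≡⟨ ⊕-assoc x (2 ^ b) y ⟨
    (x ⊕ 2 ^ b) ⊕ y   ≡⟨ cong (_⊕ y) (⊕-comm x (2 ^ b)) ⟩
    (2 ^ b ⊕ x) ⊕ y   ≡⟨ ⊕-assoc (2 ^ b) x y ⟩
    2 ^ b ⊕ (x ⊕ y)   ≡⟨ 2^b⊕l≡2^b+l b (⊕-<-2^ b x<2^b y<2^b) ⟩
    2 ^ b + (x ⊕ y)   ∎
    where open ≡-Reasoning

  [2^b+x]⊕[2^b+y]≡x⊕y : (2 ^ b + x) ⊕ (2 ^ b + y) ≡ x ⊕ y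
  [2^b+x]⊕[2^b+y]≡x⊕y = begin
    (2 ^ b + x) ⊕ (2 ^ b + y)   ≡⟨ cong (_⊕ (2 ^ b + y)) (2^b⊕l≡2^b+l b x<2^b) ⟨
    (2 ^ b ⊕ x) ⊕ (2 ^ b + y)   ≡⟨ ⊕-assoc (2 ^ b) x (2 ^ b + y) ⟩
    2 ^ b ⊕ (x ⊕ (2 ^ b + y))   ≡⟨ cong (2 ^ b ⊕_) x⊕[2^b+y]≡2^b+[x⊕y] ⟩
    2 ^ b ⊕ (2 ^ b + (x ⊕ y))   ≡⟨ cong (2 ^ b ⊕_) (2^b⊕l≡2^b+l b (⊕-<-2^ b x<2^b y<2^b)) ⟨
    2 ^ b ⊕ (2 ^ b ⊕ (x ⊕ y))   ≡⟨ x⊕[x⊕y]≡y (2 ^ b) (x ⊕ y) ⟩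
    x ⊕ y                       ∎
    where open ≡-Reasoning

∑< : ℕ → (ℕ → ℕ) → ℕ
∑< zero    f = 0
∑< (suc n) f = f 0 + ∑< n (λ x → f (suc x))

syntax ∑< n (λ x → e) = ∑[ x < n ] e

∑-cong : ∀ n {f g : ℕ → ℕ} → (∀ {x} → x < n → f x ≡ g x) → ∑< n f ≡ ∑< n g
∑-cong zero    f≗g = refl
∑-cong (suc n) f≗g = cong₂ _+_ (f≗g (s≤s z≤n)) (∑-cong n (λ x<n → f≗g (s≤s x<n)))

∑-split : ∀ m n f → ∑< (m + n) f ≡ ∑< m f + ∑[ x < n ] f (m + x)
∑-split zero    n f = refl
∑-split (suc m) n f = trans (cong (f 0 +_) (∑-split m n (λ x → f (suc x)))) (sym (+-assoc (f 0) _ _))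

∑-const : ∀ n c → ∑[ _ < n ] c ≡ n * c
∑-const zero    c = refl
∑-const (suc n) c = cong (c +_) (∑-const n c)

∑-distrib-+ : ∀ n f g → ∑[ x < n ] (f x + g x) ≡ ∑< n f + ∑< n g
∑-distrib-+ zero    f g = refl
∑-distrib-+ (suc n) f g = begin
  f 0 + g 0 + ∑[ x < n ] (f (suc x) + g (suc x))   ≡⟨ cong (f 0 + g 0 +_) (∑-distrib-+ n _ _) ⟩
  f 0 + g 0 + (F + G)
    ≡⟨ solve 4 (λ a b c d → a :+ b :+ (c :+ d) := a :+ c :+ (b :+ d)) refl (f 0) (g 0) F G ⟩
  f 0 + F + (g 0 + G)                               ∎
  where
  open ≡-Reasoning
  F = ∑[ x < n ] f (suc x)
  G = ∑[ x < n ] g (suc x)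

*-distribˡ-∑ : ∀ k n f → k * ∑< n f ≡ ∑[ x < n ] (k * f x)
*-distribˡ-∑ k zero    f = *-zeroʳ k
*-distribˡ-∑ k (suc n) f = trans (*-distribˡ-+ k (f 0) _) (cong (k * f 0 +_) (*-distribˡ-∑ k n _))

∑-comm : ∀ m n (f : ℕ → ℕ → ℕ) → ∑[ i < m ] ∑[ j < n ] f i j ≡ ∑[ j < n ] ∑[ i < m ] f i j
∑-comm zero    n f = sym (trans (∑-const n 0) (*-zeroʳ n))
∑-comm (suc m) n f = begin
  ∑< n (f 0) + ∑[ i < m ] ∑[ j < n ] f (suc i) j   ≡⟨ cong (∑< n (f 0) +_) (∑-comm m n (λ i → f (suc i))) ⟩
  ∑< n (f 0) + ∑[ j < n ] ∑[ i < m ] f (suc i) j   ≡⟨ ∑-distrib-+ n (f 0) _ ⟨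
  ∑[ j < n ] ∑[ i < suc m ] f i j                  ∎
  where open ≡-Reasoning

-- Splitting at the top bit, translation by t < 2ᵇ keeps both halves in
-- place, while translation by 2ᵇ + t swaps them.
∑-⊕ʳ-invariant : ∀ b f {t} → t < 2 ^ b → ∑[ x < 2 ^ b ] f (x ⊕ t) ≡ ∑< (2 ^ b) f
∑-⊕ʳ-invariant zero    f (s≤s z≤n) = refl
∑-⊕ʳ-invariant (suc b) f {t} t<2P = begin
  ∑[ x < 2 * P ] f (x ⊕ t)                              ≡⟨ cong (λ m → ∑[ x < m ] f (x ⊕ t)) 2P≡P+P ⟩
  ∑[ x < P + P ] f (x ⊕ t)                              ≡⟨ ∑-split P P _ ⟩
  ∑[ x < P ] f (x ⊕ t) + ∑[ x < P ] f ((P + x) ⊕ t)     ≡⟨ halves ⟩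
  ∑< P f + ∑[ x < P ] f (P + x)                         ≡⟨ ∑-split P P f ⟨
  ∑< (P + P) f                                          ≡⟨ cong (λ m → ∑< m f) 2P≡P+P ⟨
  ∑< (2 * P) f                                          ∎
  where
  open ≡-Reasoning
  P = 2 ^ b
  2P≡P+P : 2 * P ≡ P + P
  2P≡P+P = cong (P +_) (+-identityʳ P)
  Halves : ℕ → Set
  Halves s = ∑[ x < P ] f (x ⊕ s) + ∑[ x < P ] f ((P + x) ⊕ s) ≡ ∑< P f + ∑[ x < P ] f (P + x)
  low : ∀ {s} → s < P → Halves s
  low s<P = cong₂ _+_
    (∑-⊕ʳ-invariant b f s<P)
    (trans (∑-cong P (λ x<P → cong f ([2^b+x]⊕y≡2^b+[x⊕y] b x<P s<P))) (∑-⊕ʳ-invariant b (λ y → f (P + y)) s<P))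
  high : ∀ {s} → s < P → Halves (P + s)
  high {s} s<P = trans (+-comm (∑[ x < P ] f (x ⊕ (P + s))) _) (cong₂ _+_
    (trans (∑-cong P (λ x<P → cong f ([2^b+x]⊕[2^b+y]≡x⊕y b x<P s<P))) (∑-⊕ʳ-invariant b f s<P))
    (trans (∑-cong P (λ x<P → cong f (x⊕[2^b+y]≡2^b+[x⊕y] b x<P s<P))) (∑-⊕ʳ-invariant b (λ y → f (P + y)) s<P)))
  halves : Halves t
  halves with t <? P
  ... | yes t<P = low t<P
  ... | no  t≮P = subst Halves (m+[n∸m]≡n P≤t)
                    (high (subst (t ∸ P <_) (m+n∸m≡n P P) (∸-monoˡ-< (subst (t <_) 2P≡P+P t<2P) P≤t)))
    where
    P≤t : P ≤ t
    P≤t = ≮⇒≥ t≮P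

∑-⊕ˡ-invariant : ∀ b f {t} → t < 2 ^ b → ∑[ x < 2 ^ b ] f (t ⊕ x) ≡ ∑< (2 ^ b) f
∑-⊕ˡ-invariant b f {t} t<2^b = trans (∑-cong (2 ^ b) (λ {x} _ → cong f (⊕-comm t x))) (∑-⊕ʳ-invariant b f t<2^b)

module _ {B : Set} {ℓ} {P : Pred B ℓ} (P? : Decidable P) where

  filter-map : ∀ {A : Set} (f : A → B) xs → filter P? (map f xs) ≡ map f (filter (λ x → P? (f x)) xs)
  filter-map f []       = refl
  filter-map f (x ∷ xs) with P? (f x)
  ... | yes _ = cong (f x ∷_) (filter-map f xs)
  ... | no  _ = filter-map f xs

  length-filter-concatMap-applyUpTo : ∀ (g : ℕ → List B) h n →
    length (filter P? (concatMap g (applyUpTo h n))) ≡ ∑[ x < n ] length (filter P? (g (h x)))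
  length-filter-concatMap-applyUpTo g h zero    = refl
  length-filter-concatMap-applyUpTo g h (suc n) = begin
    length (filter P? (g (h 0) ++ rest))              ≡⟨ cong length (filter-++ P? (g (h 0)) rest) ⟩
    length (filter P? (g (h 0)) ++ filter P? rest)    ≡⟨ length-++ (filter P? (g (h 0))) ⟩
    length (filter P? (g (h 0))) + length (filter P? rest)
      ≡⟨ cong (length (filter P? (g (h 0))) +_) (length-filter-concatMap-applyUpTo g (λ x → h (suc x)) n) ⟩
    ∑[ x < suc n ] length (filter P? (g (h x)))       ∎
    where
    open ≡-Reasoning
    rest = concatMap g (applyUpTo (λ x → h (suc x)) n)

countNimSum : (k n t : ℕ) → ℕ
countNimSum k n t = length (filter (λ p → nimSum p ≟ t) (tuples k n))

countNimSum-suc : ∀ k n t → countNimSum (suc k) n t ≡ ∑[ x < suc n ] countNimSum k n (x ⊕ t)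
countNimSum-suc k n t = trans
  (length-filter-concatMap-applyUpTo (λ p → nimSum p ≟ t) (λ x → map (x ∷ᵛ_) (tuples k n)) (λ x → x) (suc n))
  (∑-cong (suc n) (λ {x} _ → first-pile x))
  where
  _∷ᵛ_ : ℕ → Vec ℕ k → Vec ℕ (suc k)
  _∷ᵛ_ = _∷_
  first-pile : ∀ x → length (filter (λ p → nimSum p ≟ t) (map (x ∷ᵛ_) (tuples k n))) ≡ countNimSum k n (x ⊕ t)
  first-pile x = begin
    length (filter (λ p → nimSum p ≟ t) (map (x ∷ᵛ_) (tuples k n)))
      ≡⟨ cong length (filter-map (λ p → nimSum p ≟ t) (x ∷ᵛ_) (tuples k n)) ⟩
    length (map (x ∷ᵛ_) (filter (λ p → x ⊕ nimSum p ≟ t) (tuples k n)))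
      ≡⟨ length-map (x ∷ᵛ_) (filter (λ p → x ⊕ nimSum p ≟ t) (tuples k n)) ⟩
    length (filter (λ p → x ⊕ nimSum p ≟ t) (tuples k n))
      ≡⟨ cong length (filter-≐ (λ p → x ⊕ nimSum p ≟ t) (λ p → nimSum p ≟ x ⊕ t) (cancel , uncancel) (tuples k n)) ⟩
    countNimSum k n (x ⊕ t) ∎
    where
    open ≡-Reasoning
    cancel : ∀ {s} → x ⊕ s ≡ t → s ≡ x ⊕ t
    cancel {s} refl = sym (x⊕[x⊕y]≡y x s)
    uncancel : ∀ {s} → s ≡ x ⊕ t → x ⊕ s ≡ t
    uncancel refl = x⊕[x⊕y]≡y x t

2*⌊n/2⌋≤n : ∀ n → 2 * ⌊ n /2⌋ ≤ n
2*⌊n/2⌋≤n zero          = z≤n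
2*⌊n/2⌋≤n (suc zero)    = z≤n
2*⌊n/2⌋≤n (suc (suc n)) = subst (_≤ suc (suc n)) (sym (*-suc 2 ⌊ n /2⌋)) (s≤s (s≤s (2*⌊n/2⌋≤n n)))

n≤1+2*⌊n/2⌋ : ∀ n → n ≤ suc (2 * ⌊ n /2⌋)
n≤1+2*⌊n/2⌋ zero          = z≤n
n≤1+2*⌊n/2⌋ (suc zero)    = s≤s z≤n
n≤1+2*⌊n/2⌋ (suc (suc n)) =
  subst (λ m → suc (suc n) ≤ suc m) (sym (*-suc 2 ⌊ n /2⌋)) (s≤s (s≤s (n≤1+2*⌊n/2⌋ n)))

2^⌊log2⌋n≤n : ∀ n (rec : Acc _<_ (suc n)) → 2 ^ ⌊log2⌋ (suc n) rec ≤ suc n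
2^⌊log2⌋n≤n zero    _        = ≤-refl
2^⌊log2⌋n≤n (suc n) (acc rs) = begin
  2 * 2 ^ ⌊log2⌋ (suc ⌊ n /2⌋) _   ≤⟨ *-monoʳ-≤ 2 (2^⌊log2⌋n≤n ⌊ n /2⌋ _) ⟩
  2 * suc ⌊ n /2⌋                  ≡⟨ *-suc 2 ⌊ n /2⌋ ⟩
  2 + 2 * ⌊ n /2⌋                  ≤⟨ +-monoʳ-≤ 2 (2*⌊n/2⌋≤n n) ⟩
  suc (suc n)                      ∎
  where open ≤-Reasoning

n<2*2^⌊log2⌋n : ∀ n (rec : Acc _<_ (suc n)) → suc n < 2 * 2 ^ ⌊log2⌋ (suc n) rec
n<2*2^⌊log2⌋n zero    _        = s≤s (s≤s z≤n)
n<2*2^⌊log2⌋n (suc n) (acc rs) = begin-strict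
  suc (suc n)             ≤⟨ s≤s (s≤s (n≤1+2*⌊n/2⌋ n)) ⟩
  3 + 2 * ⌊ n /2⌋         <⟨ n<1+n _ ⟩
  2 + (2 + 2 * ⌊ n /2⌋)   ≡⟨ cong (2 +_) (*-suc 2 ⌊ n /2⌋) ⟨
  2 + 2 * suc ⌊ n /2⌋     ≡⟨ *-suc 2 (suc ⌊ n /2⌋) ⟨
  2 * suc (suc ⌊ n /2⌋)   ≤⟨ *-monoʳ-≤ 2 (n<2*2^⌊log2⌋n ⌊ n /2⌋ _) ⟩
  2 * (2 * 2 ^ ⌊log2⌋ (suc ⌊ n /2⌋) _) ∎
  where open ≤-Reasoning

2^⌊log₂n⌋≤n : ∀ n .{{_ : NonZero n}} → 2 ^ ⌊log₂ n ⌋ ≤ n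
2^⌊log₂n⌋≤n (suc n) = 2^⌊log2⌋n≤n n (<-wellFounded (suc n))

n<2^[1+⌊log₂n⌋] : ∀ n .{{_ : NonZero n}} → n < 2 ^ (1 + ⌊log₂ n ⌋)
n<2^[1+⌊log₂n⌋] (suc n) = n<2*2^⌊log2⌋n n (<-wellFounded (suc n))

module Blocks (n b c : ℕ) (1+n≡2^b+c : suc n ≡ 2 ^ b + c) (c≤2^b : c ≤ 2 ^ b) where

  B : ℕ
  B = 2 ^ b

  count : ℕ → ℕ → ℕ
  count k t = countNimSum k n t

  lower upper : ℕ → ℕ
  lower k = ∑[ t < B ] count k t
  upper k = ∑[ t < B ] count k (B + t)

  r<c⇒r<B : ∀ {r} → r < c → r < B
  r<c⇒r<B r<c = <-≤-trans r<c c≤2^b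

  count-suc : ∀ k t → count (suc k) t ≡ ∑[ x < B ] count k (x ⊕ t) + ∑[ r < c ] count k ((B + r) ⊕ t)
  count-suc k t = begin
    count (suc k) t                        ≡⟨ countNimSum-suc k n t ⟩
    ∑[ x < suc n ] count k (x ⊕ t)         ≡⟨ cong (λ m → ∑[ x < m ] count k (x ⊕ t)) 1+n≡2^b+c ⟩
    ∑[ x < B + c ] count k (x ⊕ t)         ≡⟨ ∑-split B c _ ⟩
    ∑[ x < B ] count k (x ⊕ t) + ∑[ r < c ] count k ((B + r) ⊕ t) ∎
    where open ≡-Reasoning

  count-suc-lower : ∀ k {t} → t < B → count (suc k) t ≡ lower k + ∑[ r < c ] count k (B + (r ⊕ t))
  count-suc-lower k {t} t<B = trans (count-suc k t) (cong₂ _+_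
    (∑-⊕ʳ-invariant b (count k) t<B)
    (∑-cong c (λ r<c → cong (count k) ([2^b+x]⊕y≡2^b+[x⊕y] b (r<c⇒r<B r<c) t<B))))

  count-suc-upper : ∀ k {t} → t < B → count (suc k) (B + t) ≡ upper k + ∑[ r < c ] count k (r ⊕ t)
  count-suc-upper k {t} t<B = trans (count-suc k (B + t)) (cong₂ _+_
    (trans (∑-cong B (λ x<B → cong (count k) (x⊕[2^b+y]≡2^b+[x⊕y] b x<B t<B)))
           (∑-⊕ʳ-invariant b (λ y → count k (B + y)) t<B))
    (∑-cong c (λ r<c → cong (count k) ([2^b+x]⊕[2^b+y]≡x⊕y b (r<c⇒r<B r<c) t<B))))

  lower-suc : ∀ k → lower (suc k) ≡ B * lower k + c * upper k
  lower-suc k = begin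
    ∑[ t < B ] count (suc k) t                                     ≡⟨ ∑-cong B (count-suc-lower k) ⟩
    ∑[ t < B ] (lower k + ∑[ r < c ] count k (B + (r ⊕ t)))        ≡⟨ ∑-distrib-+ B _ _ ⟩
    ∑[ _ < B ] lower k + ∑[ t < B ] ∑[ r < c ] count k (B + (r ⊕ t))
      ≡⟨ cong₂ _+_ (∑-const B (lower k)) (∑-comm B c _) ⟩
    B * lower k + ∑[ r < c ] ∑[ t < B ] count k (B + (r ⊕ t))
      ≡⟨ cong (B * lower k +_) (∑-cong c (λ r<c → ∑-⊕ˡ-invariant b (λ y → count k (B + y)) (r<c⇒r<B r<c))) ⟩
    B * lower k + ∑[ _ < c ] upper k                               ≡⟨ cong (B * lower k +_) (∑-const c (upper k)) ⟩
    B * lower k + c * upper k                                      ∎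
    where open ≡-Reasoning

  upper-suc : ∀ k → upper (suc k) ≡ B * upper k + c * lower k
  upper-suc k = begin
    ∑[ t < B ] count (suc k) (B + t)                               ≡⟨ ∑-cong B (count-suc-upper k) ⟩
    ∑[ t < B ] (upper k + ∑[ r < c ] count k (r ⊕ t))              ≡⟨ ∑-distrib-+ B _ _ ⟩
    ∑[ _ < B ] upper k + ∑[ t < B ] ∑[ r < c ] count k (r ⊕ t)
      ≡⟨ cong₂ _+_ (∑-const B (upper k)) (∑-comm B c _) ⟩
    B * upper k + ∑[ r < c ] ∑[ t < B ] count k (r ⊕ t)
      ≡⟨ cong (B * upper k +_) (∑-cong c (λ r<c → ∑-⊕ˡ-invariant b (count k) (r<c⇒r<B r<c))) ⟩
    B * upper k + ∑[ _ < c ] lower k                               ≡⟨ cong (B * upper k +_) (∑-const c (lower k)) ⟩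
    B * upper k + c * lower k                                      ∎
    where open ≡-Reasoning

  0<B+t : ∀ t → 0 < B + t
  0<B+t t = <-≤-trans (m^n>0 2 b) (m≤m+n B t)

  count-zero-positive : ∀ {t} → 0 < t → count 0 t ≡ 0
  count-zero-positive (s≤s z≤n) = refl

  lower-zero : lower 0 ≡ 1
  lower-zero = go B (m^n>0 2 b)
    where
    go : ∀ m → 0 < m → ∑[ t < m ] count 0 t ≡ 1
    go (suc m) _ = cong suc (trans (∑-const m 0) (*-zeroʳ m))

  upper-zero : upper 0 ≡ 0
  upper-zero = trans (∑-cong B (λ {t} _ → count-zero-positive (0<B+t t))) (trans (∑-const B 0) (*-zeroʳ B))

  LowerFlat UpperFlat : ℕ → Set
  LowerFlat k = ∀ {t} → t < B → B * count k t ≡ lower k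
  UpperFlat k = ∀ {t} → t < B → B * count k (B + t) ≡ upper k

  upperFlat⇒lowerFlat-suc : ∀ k → UpperFlat k → LowerFlat (suc k)
  upperFlat⇒lowerFlat-suc k flat {t} t<B = begin
    B * count (suc k) t                                           ≡⟨ cong (B *_) (count-suc-lower k t<B) ⟩
    B * (lower k + ∑[ r < c ] count k (B + (r ⊕ t)))              ≡⟨ *-distribˡ-+ B (lower k) _ ⟩
    B * lower k + B * ∑[ r < c ] count k (B + (r ⊕ t))            ≡⟨ cong (B * lower k +_) (*-distribˡ-∑ B c _) ⟩
    B * lower k + ∑[ r < c ] (B * count k (B + (r ⊕ t)))
      ≡⟨ cong (B * lower k +_) (∑-cong c (λ r<c → flat (⊕-<-2^ b (r<c⇒r<B r<c) t<B))) ⟩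
    B * lower k + ∑[ _ < c ] upper k                              ≡⟨ cong (B * lower k +_) (∑-const c (upper k)) ⟩
    B * lower k + c * upper k                                     ≡⟨ lower-suc k ⟨
    lower (suc k)                                                 ∎
    where open ≡-Reasoning

  lowerFlat⇒upperFlat-suc : ∀ k → LowerFlat k → UpperFlat (suc k)
  lowerFlat⇒upperFlat-suc k flat {t} t<B = begin
    B * count (suc k) (B + t)                                     ≡⟨ cong (B *_) (count-suc-upper k t<B) ⟩
    B * (upper k + ∑[ r < c ] count k (r ⊕ t))                    ≡⟨ *-distribˡ-+ B (upper k) _ ⟩
    B * upper k + B * ∑[ r < c ] count k (r ⊕ t)                  ≡⟨ cong (B * upper k +_) (*-distribˡ-∑ B c _) ⟩
    B * upper k + ∑[ r < c ] (B * count k (r ⊕ t))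
      ≡⟨ cong (B * upper k +_) (∑-cong c (λ r<c → flat (⊕-<-2^ b (r<c⇒r<B r<c) t<B))) ⟩
    B * upper k + ∑[ _ < c ] lower k                              ≡⟨ cong (B * upper k +_) (∑-const c (lower k)) ⟩
    B * upper k + c * lower k                                     ≡⟨ upper-suc k ⟨
    upper (suc k)                                                 ∎
    where open ≡-Reasoning

  upperFlat-zero : UpperFlat 0
  upperFlat-zero {t} _ = trans (cong (B *_) (count-zero-positive (0<B+t t))) (trans (*-zeroʳ B) (sym upper-zero))

  upperFlat-even : ∀ m → UpperFlat (2 * m)
  upperFlat-even zero    = upperFlat-zero
  upperFlat-even (suc m) =
    subst UpperFlat (sym (*-suc 2 m))
      (lowerFlat⇒upperFlat-suc (suc (2 * m)) (upperFlat⇒lowerFlat-suc (2 * m) (upperFlat-even m)))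

  lowerFlat-odd : ∀ m → LowerFlat (suc (2 * m))
  lowerFlat-odd m = upperFlat⇒lowerFlat-suc (2 * m) (upperFlat-even m)

  lower+upper : ∀ k → lower k + upper k ≡ (B + c) ^ k
  lower+upper zero    = cong₂ _+_ lower-zero upper-zero
  lower+upper (suc k) = begin
    lower (suc k) + upper (suc k)                  ≡⟨ cong₂ _+_ (lower-suc k) (upper-suc k) ⟩
    B * lower k + c * upper k + (B * upper k + c * lower k)
      ≡⟨ solve 4 (λ B c l u → B :* l :+ c :* u :+ (B :* u :+ c :* l) := (B :+ c) :* (l :+ u)) refl B c (lower k) (upper k) ⟩
    (B + c) * (lower k + upper k)                  ≡⟨ cong ((B + c) *_) (lower+upper k) ⟩
    (B + c) ^ suc k                                ∎
    where open ≡-Reasoning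

  lower≡upper+[B∸c]^ : ∀ k → lower k ≡ upper k + (B ∸ c) ^ k
  lower≡upper+[B∸c]^ zero    = trans lower-zero (cong (_+ 1) (sym upper-zero))
  lower≡upper+[B∸c]^ (suc k) = begin
    lower (suc k)                                  ≡⟨ lower-suc k ⟩
    B * lower k + c * upper k                      ≡⟨ cong (λ l → B * l + c * upper k) (lower≡upper+[B∸c]^ k) ⟩
    B * (upper k + d ^ k) + c * upper k            ≡⟨ cong (λ B → B * (upper k + d ^ k) + c * upper k) B≡c+d ⟩
    (c + d) * (upper k + d ^ k) + c * upper k
      ≡⟨ solve 4 (λ c d u e → (c :+ d) :* (u :+ e) :+ c :* u := (c :+ d) :* u :+ c :* (u :+ e) :+ d :* e) refl c d (upper k) (d ^ k) ⟩
    (c + d) * upper k + c * (upper k + d ^ k) + d * d ^ k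
      ≡⟨ cong (λ B → B * upper k + c * (upper k + d ^ k) + d * d ^ k) B≡c+d ⟨
    B * upper k + c * (upper k + d ^ k) + d * d ^ k
      ≡⟨ cong (λ l → B * upper k + c * l + d * d ^ k) (lower≡upper+[B∸c]^ k) ⟨
    B * upper k + c * lower k + d ^ suc k          ≡⟨ cong (_+ d ^ suc k) (upper-suc k) ⟨
    upper (suc k) + d ^ suc k                      ∎
    where
    open ≡-Reasoning
    d = B ∸ c
    B≡c+d : B ≡ c + d
    B≡c+d = sym (m+[n∸m]≡n c≤2^b)

  count-odd-closed-form : ∀ m → let k = suc (2 * m) in
    count k 0 * (2 * B) ≡ (B + c) ^ k + (B ∸ c) ^ k
  count-odd-closed-form m = begin
    count k 0 * (2 * B)                  ≡⟨ solve 2 (λ x B → x :* (con 2 :* B) := B :* x :+ B :* x) refl (count k 0) B ⟩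
    B * count k 0 + B * count k 0        ≡⟨ cong₂ _+_ B*count≡lower B*count≡lower ⟩
    lower k + lower k                    ≡⟨ cong (lower k +_) (lower≡upper+[B∸c]^ k) ⟩
    lower k + (upper k + (B ∸ c) ^ k)    ≡⟨ +-assoc (lower k) (upper k) _ ⟨
    lower k + upper k + (B ∸ c) ^ k      ≡⟨ cong (_+ (B ∸ c) ^ k) (lower+upper k) ⟩
    (B + c) ^ k + (B ∸ c) ^ k            ∎
    where
    open ≡-Reasoning
    k = suc (2 * m)
    B*count≡lower : B * count k 0 ≡ lower k
    B*count≡lower = lowerFlat-odd m (m^n>0 2 b)

theorem15 : (k : ℕ) → (∃ λ m → k ≡ 2 * m + 1) → (n : ℕ) → .{{_ : NonZero n}} →
    let b = ⌊log₂ n ⌋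
        c = n + 1 ∸ 2 ^ b
    in a k n * 2 ^ (b + 1) ≡ (2 ^ b + c) ^ k + (2 ^ b ∸ c) ^ k
theorem15 .(2 * m + 1) (m , refl) n rewrite +-comm (2 * m) 1 | +-comm ⌊log₂ n ⌋ 1 =
  Blocks.count-odd-closed-form n b c 1+n≡2^b+c c≤2^b m
  where
  b = ⌊log₂ n ⌋
  c = n + 1 ∸ 2 ^ b
  1+n≡2^b+c : suc n ≡ 2 ^ b + c
  1+n≡2^b+c = trans (+-comm 1 n) (sym (m+[n∸m]≡n (m≤n⇒m≤n+o 1 (2^⌊log₂n⌋≤n n))))
  c≤2^b : c ≤ 2 ^ b
  c≤2^b = begin
    n + 1 ∸ 2 ^ b           ≤⟨ ∸-monoˡ-≤ (2 ^ b) (subst (_≤ 2 * 2 ^ b) (+-comm 1 n) (n<2^[1+⌊log₂n⌋] n)) ⟩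
    2 ^ b + (2 ^ b + 0) ∸ 2 ^ b ≡⟨ m+n∸m≡n (2 ^ b) (2 ^ b + 0) ⟩
    2 ^ b + 0               ≡⟨ +-identityʳ (2 ^ b) ⟩
    2 ^ b                   ∎
    where open ≤-Reasoning
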